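{- Let $G_1$ and $G_2$ be simple graphs with cordial labelings $f:V(G_1)\to\{0,1\}$ and $g:V(G_2)\to\{0,1\}$ respectively, and suppose $G_1$ is connected, bipartite, and has an even number of edges. Then the induced labeling $h:V(G_1\times G_2)\to\{0,1\}$, $h(u,v)=f(u)+g(v)\pmod 2$, is a cordial labeling of the tensor product $G_1\times G_2$.
   Context: A binary labeling of a graph $G$ is a map $f:V(G)\to\{0,1\}$, inducing an edge labeling $f_e(uv)=f(u)+f(v)\pmod 2$. Two real numbers $x,y$ are roughly equal if $|x-y|\le 1$. A binary labeling $f$ is friendly if $|f^{ -1}(0)|$ and $|f^{ -1}(1)|$ are roughly equal, and cordial if it is friendly and $|f_e^{ -1}(0)|$ and $|f_e^{ -1}(1)|$ are roughly equal. The tensor product $G_1\times G_2$ has vertex set $V(G_1)\times V(G_2)$, with $(u_1,u_2)$ adjacent to $(v_1,v_2)$ if and only if $u_1v_1\in E(G_1)$ and $u_2v_2\in E(G_2)$. -}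

module Defs where

open import Data.Nat using (ℕ; zero; suc; _+_; _*_; _≤_; _<ᵇ_)
open import Data.Bool using (Bool; true; false; if_then_else_; _∧_; _xor_; not)
open import Data.Fin using (Fin; toℕ; remQuot)
import Data.Fin as Fin
open import Data.Product using (_×_; _,_; Σ; proj₁; proj₂)
open import Relation.Binary.PropositionalEquality using (_≡_; _≢_)

Adj : ℕ → Set
Adj n = Fin n → Fin n → Bool

IsSimple : ∀ {n} → Adj n → Set
IsSimple {n} A = (∀ (u v : Fin n) → A u v ≡ A v u) × (∀ (u : Fin n) → A u u ≡ false)

count : ∀ {n} → (Fin n → Bool) → ℕ
count {zero}  p = 0
count {suc n} p = (if p Fin.zero then 1 else 0) + count (λ i → p (Fin.suc i))

-- Binary labelings; Bool encodes {0,1} (false = 0, true = 1); addition mod 2 is xor.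
Labeling : ℕ → Set
Labeling n = Fin n → Bool

edgeLabel : ∀ {n} → Labeling n → Fin n → Fin n → Bool
edgeLabel f u v = f u xor f v

RoughlyEqual : ℕ → ℕ → Set
RoughlyEqual x y = (x ≤ suc y) × (y ≤ suc x)

eqB : Bool → Bool → Bool
eqB a b = not (a xor b)

vertexCount : ∀ {n} → Labeling n → Bool → ℕ
vertexCount f b = count (λ v → eqB (f v) b)

sumOver : ∀ {m} → (Fin m → ℕ) → ℕ
sumOver {zero}  g = 0
sumOver {suc m} g = g Fin.zero + sumOver (λ i → g (Fin.suc i))

-- number of edges {u,v} of the graph (each counted once, via toℕ u < toℕ v)
-- whose induced edge label is b, i.e. |f_e⁻¹(b)|
edgeCount : ∀ {n} → Adj n → Labeling n → Bool → ℕ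
edgeCount A f b = sumOver (λ u → count (λ v → (toℕ u <ᵇ toℕ v) ∧ A u v ∧ eqB (edgeLabel f u v) b))

numEdges : ∀ {n} → Adj n → ℕ
numEdges A = sumOver (λ u → count (λ v → (toℕ u <ᵇ toℕ v) ∧ A u v))

Friendly : ∀ {n} → Labeling n → Set
Friendly f = RoughlyEqual (vertexCount f false) (vertexCount f true)

Cordial : ∀ {n} → Adj n → Labeling n → Set
Cordial A f = Friendly f × RoughlyEqual (edgeCount A f false) (edgeCount A f true)

data Walk {n} (A : Adj n) : Fin n → Fin n → Set where
  here : ∀ {u} → Walk A u u
  step : ∀ {u v w} → A u v ≡ true → Walk A v w → Walk A u w

Connected : ∀ {n} → Adj n → Set
Connected {n} A = ∀ (u v : Fin n) → Walk A u v

Bipartite : ∀ {n} → Adj n → Set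
Bipartite {n} A = Σ (Fin n → Bool) λ c → ∀ (u v : Fin n) → A u v ≡ true → c u ≢ c v

Even : ℕ → Set
Even k = Σ ℕ λ m → k ≡ m + m

-- Tensor product G₁ × G₂ on vertex set Fin (n₁ * n₂) ≅ Fin n₁ × Fin n₂ (via remQuot).
tensor : ∀ {n₁ n₂} → Adj n₁ → Adj n₂ → Adj (n₁ * n₂)
tensor {n₁} {n₂} A B x y =
  A (proj₁ (remQuot {n₁} n₂ x)) (proj₁ (remQuot {n₁} n₂ y)) ∧
  B (proj₂ (remQuot {n₁} n₂ x)) (proj₂ (remQuot {n₁} n₂ y))

productLabeling : ∀ {n₁ n₂} → Labeling n₁ → Labeling n₂ → Labeling (n₁ * n₂)
productLabeling {n₁} {n₂} f g x = f (proj₁ (remQuot {n₁} n₂ x)) xor g (proj₂ (remQuot {n₁} n₂ x))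

-- Count edges in both directions ("arcs").  Under h(u, v) = f(u) + g(v) the label of an arc of
-- G₁ × G₂ is the sum of the labels of its two projections, so if aᵢ(c) is the number of arcs
-- of Gᵢ labelled c, then G₁ × G₂ has a₁(0)a₂(c) + a₁(1)a₂(1 − c) arcs labelled c; the same
-- bilinear formula counts the vertices of each label.  An even number of edges turns the
-- cordiality of f into a₁(0) = a₁(1), which makes the two arc counts of G₁ × G₂ equal.  On
-- vertices the two counts differ by the product of the imbalances of f and g, which is at
-- most 1 in absolute value.
module Submission where

open import Defs
open import Algebra.Bundles using (CommutativeRing)
import Algebra.Properties.CommutativeSemigroup as CommutativeSemigroupProperties
open import Data.Bool using (Bool; true; false; not; _∧_; _xor_; if_then_else_)
open import Data.Bool.Properties using (xor-comm; xor-∧-commutativeRing)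
open import Data.Fin using (Fin; toℕ; remQuot; combine; _↑ˡ_; _↑ʳ_)
import Data.Fin as Fin
open import Data.Fin.Properties using (remQuot-combine; toℕ-injective)
open import Data.Nat using (ℕ; zero; suc; _+_; _*_; _<ᵇ_)
open import Data.Nat.Properties
open import Data.Nat.Tactic.RingSolver using (solve-∀)
open import Data.Product using (_×_; _,_; proj₁; proj₂; swap)
open import Data.Sum using (_⊎_; inj₁; inj₂)
open import Function using (_∘_; _∘₂_)
open import Relation.Binary.Definitions using (tri<; tri≈; tri>)
open import Relation.Binary.PropositionalEquality
open import Relation.Nullary.Negation using (contradiction)
open import Relation.Nullary.Reflects using (ofʸ; ofⁿ)

open ≡-Reasoning

⟦_⟧ : Bool → ℕ
⟦ b ⟧ = if b then 1 else 0

count≡sumOver : ∀ {n} (p : Fin n → Bool) → count p ≡ sumOver (λ i → ⟦ p i ⟧)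
count≡sumOver {zero}  p = refl
count≡sumOver {suc n} p = cong (⟦ p Fin.zero ⟧ +_) (count≡sumOver (p ∘ Fin.suc))

sumOver-cong : ∀ {m} {F G : Fin m → ℕ} → (∀ i → F i ≡ G i) → sumOver F ≡ sumOver G
sumOver-cong {zero}  F≗G = refl
sumOver-cong {suc m} F≗G = cong₂ _+_ (F≗G Fin.zero) (sumOver-cong (F≗G ∘ Fin.suc))

sumOver-zero : ∀ m → sumOver {m} (λ _ → 0) ≡ 0
sumOver-zero zero    = refl
sumOver-zero (suc m) = sumOver-zero m

sumOver-+ : ∀ {m} (F G : Fin m → ℕ) → sumOver (λ i → F i + G i) ≡ sumOver F + sumOver G
sumOver-+ {zero}  F G = refl
sumOver-+ {suc m} F G = begin
  (F Fin.zero + G Fin.zero) + sumOver (λ i → F (Fin.suc i) + G (Fin.suc i))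
    ≡⟨ cong (F Fin.zero + G Fin.zero +_) (sumOver-+ (F ∘ Fin.suc) (G ∘ Fin.suc)) ⟩
  (F Fin.zero + G Fin.zero) + (sumOver (F ∘ Fin.suc) + sumOver (G ∘ Fin.suc))
    ≡⟨ +-interchange (F Fin.zero) (G Fin.zero) _ _ ⟩
  (F Fin.zero + sumOver (F ∘ Fin.suc)) + (G Fin.zero + sumOver (G ∘ Fin.suc)) ∎
  where open CommutativeSemigroupProperties +-commutativeSemigroup renaming (interchange to +-interchange)

sumOver-*ˡ : ∀ {m} c (F : Fin m → ℕ) → sumOver (λ i → c * F i) ≡ c * sumOver F
sumOver-*ˡ {zero}  c F = sym (*-zeroʳ c)
sumOver-*ˡ {suc m} c F =
  trans (cong (c * F Fin.zero +_) (sumOver-*ˡ c (F ∘ Fin.suc))) (sym (*-distribˡ-+ c _ _))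

sumOver-*ʳ : ∀ {m} c (F : Fin m → ℕ) → sumOver (λ i → F i * c) ≡ sumOver F * c
sumOver-*ʳ {zero}  c F = refl
sumOver-*ʳ {suc m} c F =
  trans (cong (F Fin.zero * c +_) (sumOver-*ʳ c (F ∘ Fin.suc))) (sym (*-distribʳ-+ c (F Fin.zero) _))

sumOver-comm : ∀ {m n} (F : Fin m → Fin n → ℕ) →
  sumOver (λ i → sumOver (F i)) ≡ sumOver (λ j → sumOver (λ i → F i j))
sumOver-comm {zero}  {n} F = sym (sumOver-zero n)
sumOver-comm {suc m}     F =
  trans (cong (sumOver (F Fin.zero) +_) (sumOver-comm (F ∘ Fin.suc)))
        (sym (sumOver-+ (F Fin.zero) (λ j → sumOver (λ i → F (Fin.suc i) j))))

sumOver-↑ : ∀ m {n} (F : Fin (m + n) → ℕ) →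
  sumOver F ≡ sumOver (λ i → F (i ↑ˡ n)) + sumOver (λ j → F (m ↑ʳ j))
sumOver-↑ zero    F = refl
sumOver-↑ (suc m) F =
  trans (cong (F Fin.zero +_) (sumOver-↑ m (F ∘ Fin.suc))) (sym (+-assoc (F Fin.zero) _ _))

sumOver-combine : ∀ m {n} (F : Fin (m * n) → ℕ) →
  sumOver F ≡ sumOver (λ i → sumOver (λ j → F (combine {m} {n} i j)))
sumOver-combine zero        F = refl
sumOver-combine (suc m) {n} F =
  trans (sumOver-↑ n F) (cong (sumOver (λ j → F (j ↑ˡ (m * n))) +_) (sumOver-combine m (F ∘ (n ↑ʳ_))))

sumOver-remQuot : ∀ m n (φ : Fin m × Fin n → ℕ) →
  sumOver (λ x → φ (remQuot {m} n x)) ≡ sumOver (λ i → sumOver (λ j → φ (i , j)))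
sumOver-remQuot m n φ = trans (sumOver-combine m _)
  (sumOver-cong (λ i → sumOver-cong (λ j → cong φ (remQuot-combine i j))))

sumOver² : ∀ {m n} → (Fin m → Fin n → ℕ) → ℕ
sumOver² F = sumOver (λ i → sumOver (F i))

sumOver²-cong : ∀ {m n} {F G : Fin m → Fin n → ℕ} → (∀ i j → F i j ≡ G i j) → sumOver² F ≡ sumOver² G
sumOver²-cong F≗G = sumOver-cong (λ i → sumOver-cong (F≗G i))

sumOver-count : ∀ {m n} (p : Fin m → Fin n → Bool) →
  sumOver (λ i → count (p i)) ≡ sumOver² (λ i j → ⟦ p i j ⟧)
sumOver-count p = sumOver-cong (λ i → count≡sumOver (p i))

sumOver²-+ : ∀ {m n} (F G : Fin m → Fin n → ℕ) →
  sumOver² (λ i j → F i j + G i j) ≡ sumOver² F + sumOver² G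
sumOver²-+ F G =
  trans (sumOver-cong (λ i → sumOver-+ (F i) (G i))) (sumOver-+ (sumOver ∘ F) (sumOver ∘ G))

sumOver-linearˡ : ∀ {m} c₀ c₁ (F₀ F₁ : Fin m → ℕ) →
  sumOver (λ i → c₀ * F₀ i + c₁ * F₁ i) ≡ c₀ * sumOver F₀ + c₁ * sumOver F₁
sumOver-linearˡ c₀ c₁ F₀ F₁ =
  trans (sumOver-+ (λ i → c₀ * F₀ i) (λ i → c₁ * F₁ i))
        (cong₂ _+_ (sumOver-*ˡ c₀ F₀) (sumOver-*ˡ c₁ F₁))

sumOver-linearʳ : ∀ {m} (F₀ F₁ : Fin m → ℕ) c₀ c₁ →
  sumOver (λ i → F₀ i * c₀ + F₁ i * c₁) ≡ sumOver F₀ * c₀ + sumOver F₁ * c₁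
sumOver-linearʳ F₀ F₁ c₀ c₁ =
  trans (sumOver-+ (λ i → F₀ i * c₀) (λ i → F₁ i * c₁))
        (cong₂ _+_ (sumOver-*ʳ c₀ F₀) (sumOver-*ʳ c₁ F₁))

sumOver-bilinear : ∀ {m n} (X₀ X₁ : Fin m → ℕ) (Y₀ Y₁ : Fin n → ℕ) →
  sumOver² (λ i j → X₀ i * Y₀ j + X₁ i * Y₁ j)
    ≡ sumOver X₀ * sumOver Y₀ + sumOver X₁ * sumOver Y₁
sumOver-bilinear X₀ X₁ Y₀ Y₁ =
  trans (sumOver-cong (λ i → sumOver-linearˡ (X₀ i) (X₁ i) Y₀ Y₁)) (sumOver-linearʳ X₀ X₁ _ _)

sumOver²-bilinear : ∀ {m n} (X₀ X₁ : Fin m → Fin m → ℕ) (Y₀ Y₁ : Fin n → Fin n → ℕ) →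
  sumOver² (λ i i' → sumOver² (λ j j' → X₀ i i' * Y₀ j j' + X₁ i i' * Y₁ j j'))
    ≡ sumOver² X₀ * sumOver² Y₀ + sumOver² X₁ * sumOver² Y₁
sumOver²-bilinear X₀ X₁ Y₀ Y₁ = begin
  sumOver² (λ i i' → sumOver² (λ j j' → X₀ i i' * Y₀ j j' + X₁ i i' * Y₁ j j'))
    ≡⟨ sumOver²-cong (λ i i' → trans
         (sumOver-cong (λ j → sumOver-linearˡ (X₀ i i') (X₁ i i') (Y₀ j) (Y₁ j)))
         (sumOver-linearˡ (X₀ i i') (X₁ i i') (sumOver ∘ Y₀) (sumOver ∘ Y₁))) ⟩
  sumOver² (λ i i' → X₀ i i' * sumOver² Y₀ + X₁ i i' * sumOver² Y₁)
    ≡⟨ sumOver-cong (λ i → sumOver-linearʳ (X₀ i) (X₁ i) _ _) ⟩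
  sumOver (λ i → sumOver (X₀ i) * sumOver² Y₀ + sumOver (X₁ i) * sumOver² Y₁)
    ≡⟨ sumOver-linearʳ (sumOver ∘ X₀) (sumOver ∘ X₁) _ _ ⟩
  sumOver² X₀ * sumOver² Y₀ + sumOver² X₁ * sumOver² Y₁ ∎

sumOver²-symmetric : ∀ {n} (F : Fin n → Fin n → Bool) →
  (∀ u v → F u v ≡ F v u) → (∀ u → F u u ≡ false) →
  sumOver² (λ u v → ⟦ F u v ⟧) ≡ 2 * sumOver (λ u → count (λ v → (toℕ u <ᵇ toℕ v) ∧ F u v))
sumOver²-symmetric {n} F F-sym F-irrefl = begin
  sumOver² (λ u v → ⟦ F u v ⟧)                       ≡⟨ sumOver²-cong split ⟩
  sumOver² (λ u v → ⟦ upper u v ⟧ + ⟦ upper v u ⟧)   ≡⟨ sumOver²-+ (λ u v → ⟦ upper u v ⟧) _ ⟩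
  S + sumOver² (λ u v → ⟦ upper v u ⟧)               ≡⟨ cong (S +_) (sym (sumOver-comm (⟦_⟧ ∘₂ upper))) ⟩
  S + S                                              ≡⟨ cong (S +_) (sym (+-identityʳ S)) ⟩
  2 * S                                              ≡⟨ cong (2 *_) (sym (sumOver-count upper)) ⟩
  2 * sumOver (λ u → count (upper u))                ∎
  where
  upper : Fin n → Fin n → Bool
  upper u v = (toℕ u <ᵇ toℕ v) ∧ F u v

  S : ℕ
  S = sumOver² (λ u v → ⟦ upper u v ⟧)

  split : ∀ u v → ⟦ F u v ⟧ ≡ ⟦ upper u v ⟧ + ⟦ upper v u ⟧
  split u v with toℕ u <ᵇ toℕ v | <ᵇ-reflects-< (toℕ u) (toℕ v)
               | toℕ v <ᵇ toℕ u | <ᵇ-reflects-< (toℕ v) (toℕ u)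
  ... | true  | ofʸ u<v | true  | ofʸ v<u = contradiction u<v (<-asym v<u)
  ... | true  | ofʸ _   | false | ofⁿ _   = sym (+-identityʳ _)
  ... | false | ofⁿ _   | true  | ofʸ _   = cong ⟦_⟧ (F-sym u v)
  ... | false | ofⁿ u≮v | false | ofⁿ v≮u
    rewrite toℕ-injective {i = u} {j = v} (≤-antisym (≮⇒≥ v≮u) (≮⇒≥ u≮v)) = cong ⟦_⟧ (F-irrefl v)

labelledArc : ∀ {n} → Adj n → Labeling n → Bool → Fin n → Fin n → Bool
labelledArc A f b u v = A u v ∧ eqB (edgeLabel f u v) b

arcCount : ∀ {n} → Adj n → Labeling n → Bool → ℕ
arcCount A f b = sumOver² (λ u v → ⟦ labelledArc A f b u v ⟧)

arcCount≡2*edgeCount : ∀ {n} (A : Adj n) (f : Labeling n) b → IsSimple A →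
  arcCount A f b ≡ 2 * edgeCount A f b
arcCount≡2*edgeCount A f b (A-sym , A-irrefl) = sumOver²-symmetric (labelledArc A f b)
  (λ u v → cong₂ (λ a l → a ∧ eqB l b) (A-sym u v) (xor-comm (f u) (f v)))
  (λ u → cong (_∧ _) (A-irrefl u))

⟦∧⟧-split-eqB : ∀ x y l → ⟦ x ∧ y ⟧ ≡ ⟦ x ∧ y ∧ eqB l false ⟧ + ⟦ x ∧ y ∧ eqB l true ⟧
⟦∧⟧-split-eqB false y     l     = refl
⟦∧⟧-split-eqB true  false l     = refl
⟦∧⟧-split-eqB true  true  false = refl
⟦∧⟧-split-eqB true  true  true  = refl

numEdges≡edgeCount+edgeCount : ∀ {n} (A : Adj n) (f : Labeling n) →
  numEdges A ≡ edgeCount A f false + edgeCount A f true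
numEdges≡edgeCount+edgeCount {n} A f = begin
  numEdges A
    ≡⟨ sumOver-count edge ⟩
  sumOver² (λ u v → ⟦ edge u v ⟧)
    ≡⟨ sumOver²-cong split ⟩
  sumOver² (λ u v → ⟦ edgeWith false u v ⟧ + ⟦ edgeWith true u v ⟧)
    ≡⟨ sumOver²-+ (λ u v → ⟦ edgeWith false u v ⟧) _ ⟩
  sumOver² (λ u v → ⟦ edgeWith false u v ⟧) + sumOver² (λ u v → ⟦ edgeWith true u v ⟧)
    ≡⟨ sym (cong₂ _+_ (sumOver-count (edgeWith false)) (sumOver-count (edgeWith true))) ⟩
  edgeCount A f false + edgeCount A f true ∎
  where
  edge : Fin n → Fin n → Bool
  edge u v = (toℕ u <ᵇ toℕ v) ∧ A u v

  edgeWith : Bool → Fin n → Fin n → Bool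
  edgeWith b u v = (toℕ u <ᵇ toℕ v) ∧ labelledArc A f b u v

  split : ∀ u v → ⟦ edge u v ⟧ ≡ ⟦ edgeWith false u v ⟧ + ⟦ edgeWith true u v ⟧
  split u v = ⟦∧⟧-split-eqB (toℕ u <ᵇ toℕ v) (A u v) (edgeLabel f u v)

⟦∧-eqB-xor⟧ : ∀ x y a c b →
  ⟦ (x ∧ y) ∧ eqB (a xor c) b ⟧
    ≡ ⟦ x ∧ eqB a false ⟧ * ⟦ y ∧ eqB c b ⟧ + ⟦ x ∧ eqB a true ⟧ * ⟦ y ∧ eqB c (not b) ⟧
⟦∧-eqB-xor⟧ false y     a     c     b     = refl
⟦∧-eqB-xor⟧ true  false false c     b     = refl
⟦∧-eqB-xor⟧ true  false true  c     b     = refl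
⟦∧-eqB-xor⟧ true  true  false false false = refl
⟦∧-eqB-xor⟧ true  true  false false true  = refl
⟦∧-eqB-xor⟧ true  true  false true  false = refl
⟦∧-eqB-xor⟧ true  true  false true  true  = refl
⟦∧-eqB-xor⟧ true  true  true  false false = refl
⟦∧-eqB-xor⟧ true  true  true  false true  = refl
⟦∧-eqB-xor⟧ true  true  true  true  false = refl
⟦∧-eqB-xor⟧ true  true  true  true  true  = refl

xor-interchange : ∀ a b c d → (a xor b) xor (c xor d) ≡ (a xor c) xor (b xor d)
xor-interchange = CommutativeSemigroupProperties.interchange
  (CommutativeRing.+-commutativeSemigroup xor-∧-commutativeRing)

vertexCount-productLabeling : ∀ {m n} (f : Labeling m) (g : Labeling n) b →
  vertexCount (productLabeling f g) b
    ≡ vertexCount f false * vertexCount g b + vertexCount f true * vertexCount g (not b)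
vertexCount-productLabeling {m} {n} f g b = begin
  vertexCount (productLabeling f g) b
    ≡⟨ count≡sumOver (λ x → eqB (productLabeling f g x) b) ⟩
  sumOver (λ x → ⟦ eqB (productLabeling f g x) b ⟧)
    ≡⟨ sumOver-remQuot m n (λ p → ⟦ eqB (f (proj₁ p) xor g (proj₂ p)) b ⟧) ⟩
  sumOver² (λ i j → ⟦ eqB (f i xor g j) b ⟧)
    ≡⟨ sumOver²-cong (λ i j → ⟦∧-eqB-xor⟧ true true (f i) (g j) b) ⟩
  sumOver² (λ i j → X false i * Y b j + X true i * Y (not b) j)
    ≡⟨ sumOver-bilinear (X false) (X true) (Y b) (Y (not b)) ⟩
  sumOver (X false) * sumOver (Y b) + sumOver (X true) * sumOver (Y (not b))
    ≡⟨ sym (cong₂ _+_ (cong₂ _*_ (count≡sumOver (fLabel false)) (count≡sumOver (gLabel b)))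
                      (cong₂ _*_ (count≡sumOver (fLabel true)) (count≡sumOver (gLabel (not b))))) ⟩
  vertexCount f false * vertexCount g b + vertexCount f true * vertexCount g (not b) ∎
  where
  fLabel : Bool → Fin m → Bool
  fLabel c i = eqB (f i) c

  gLabel : Bool → Fin n → Bool
  gLabel c j = eqB (g j) c

  X : Bool → Fin m → ℕ
  X c i = ⟦ fLabel c i ⟧

  Y : Bool → Fin n → ℕ
  Y c j = ⟦ gLabel c j ⟧

arcCount-tensor : ∀ {m n} (G₁ : Adj m) (G₂ : Adj n) (f : Labeling m) (g : Labeling n) b →
  arcCount (tensor G₁ G₂) (productLabeling f g) b
    ≡ arcCount G₁ f false * arcCount G₂ g b + arcCount G₁ f true * arcCount G₂ g (not b)
arcCount-tensor {m} {n} G₁ G₂ f g b = begin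
  arcCount (tensor G₁ G₂) (productLabeling f g) b
    ≡⟨ sumOver-cong (λ x → sumOver-remQuot m n (Φ (remQuot n x))) ⟩
  sumOver (λ x → sumOver² (λ i' j' → Φ (remQuot n x) (i' , j')))
    ≡⟨ sumOver-remQuot m n (λ p → sumOver² (λ i' j' → Φ p (i' , j'))) ⟩
  sumOver² (λ i j → sumOver² (λ i' j' → Φ (i , j) (i' , j')))
    ≡⟨ sumOver-cong (λ i → sumOver-comm (λ j i' → sumOver (λ j' → Φ (i , j) (i' , j')))) ⟩
  sumOver² (λ i i' → sumOver² (λ j j' → Φ (i , j) (i' , j')))
    ≡⟨ sumOver²-cong (λ i i' → sumOver²-cong (factor i i')) ⟩
  sumOver² (λ i i' → sumOver² (λ j j' → X false i i' * Y b j j' + X true i i' * Y (not b) j j'))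
    ≡⟨ sumOver²-bilinear (X false) (X true) (Y b) (Y (not b)) ⟩
  arcCount G₁ f false * arcCount G₂ g b + arcCount G₁ f true * arcCount G₂ g (not b) ∎
  where
  Φ : Fin m × Fin n → Fin m × Fin n → ℕ
  Φ (i , j) (i' , j') = ⟦ (G₁ i i' ∧ G₂ j j') ∧ eqB ((f i xor g j) xor (f i' xor g j')) b ⟧

  X : Bool → Fin m → Fin m → ℕ
  X c i i' = ⟦ labelledArc G₁ f c i i' ⟧

  Y : Bool → Fin n → Fin n → ℕ
  Y c j j' = ⟦ labelledArc G₂ g c j j' ⟧

  factor : ∀ i i' j j' → Φ (i , j) (i' , j') ≡ X false i i' * Y b j j' + X true i i' * Y (not b) j j'
  factor i i' j j' = begin
    ⟦ (G₁ i i' ∧ G₂ j j') ∧ eqB ((f i xor g j) xor (f i' xor g j')) b ⟧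
      ≡⟨ cong (λ l → ⟦ (G₁ i i' ∧ G₂ j j') ∧ eqB l b ⟧) (xor-interchange (f i) (g j) (f i') (g j')) ⟩
    ⟦ (G₁ i i' ∧ G₂ j j') ∧ eqB ((f i xor f i') xor (g j xor g j')) b ⟧
      ≡⟨ ⟦∧-eqB-xor⟧ (G₁ i i') (G₂ j j') (f i xor f i') (g j xor g j') b ⟩
    X false i i' * Y b j j' + X true i i' * Y (not b) j j' ∎

tensor-isSimple : ∀ {m n} (G₁ : Adj m) (G₂ : Adj n) →
  IsSimple G₁ → IsSimple G₂ → IsSimple (tensor G₁ G₂)
tensor-isSimple {m} {n} G₁ G₂ (sym₁ , irrefl₁) (sym₂ , _) =
  (λ x y → cong₂ _∧_ (sym₁ (left x) (left y)) (sym₂ (right x) (right y))) ,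
  (λ x → cong (_∧ _) (irrefl₁ (left x)))
  where
  left : Fin (m * n) → Fin m
  left x = proj₁ (remQuot n x)

  right : Fin (m * n) → Fin n
  right x = proj₂ (remQuot {m} n x)

≡⇒RoughlyEqual : ∀ {x y} → x ≡ y → RoughlyEqual x y
≡⇒RoughlyEqual {x} refl = n≤1+n x , n≤1+n x

suc⇒RoughlyEqual : ∀ {x y} → x ≡ suc y → RoughlyEqual x y
suc⇒RoughlyEqual {y = y} refl = ≤-refl , m≤n⇒m≤1+n (n≤1+n y)

RoughlyEqual-sym : ∀ {x y} → RoughlyEqual x y → RoughlyEqual y x
RoughlyEqual-sym = swap

RoughlyEqual-cases : ∀ {x y} → RoughlyEqual x y → x ≡ y ⊎ x ≡ suc y ⊎ y ≡ suc x
RoughlyEqual-cases {x} {y} (x≤1+y , y≤1+x) with <-cmp x y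
... | tri< x<y _ _ = inj₂ (inj₂ (≤-antisym y≤1+x x<y))
... | tri≈ _ x≡y _ = inj₁ x≡y
... | tri> _ _ y<x = inj₂ (inj₁ (≤-antisym x≤1+y y<x))

suc-cross : ∀ a c → suc a * suc c + a * c ≡ suc (suc a * c + a * suc c)
suc-cross = solve-∀

suc-cross′ : ∀ a c → a * c + suc a * suc c ≡ suc (a * suc c + suc a * c)
suc-cross′ = solve-∀

RoughlyEqual-cross : ∀ {a₀ a₁ b₀ b₁} → RoughlyEqual a₀ a₁ → RoughlyEqual b₀ b₁ →
  RoughlyEqual (a₀ * b₀ + a₁ * b₁) (a₀ * b₁ + a₁ * b₀)
RoughlyEqual-cross {a₀} {a₁} {b₀} {b₁} a₀≈a₁ b₀≈b₁
  with RoughlyEqual-cases a₀≈a₁ | RoughlyEqual-cases b₀≈b₁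
... | inj₁ refl        | _                = ≡⇒RoughlyEqual (+-comm (a₀ * b₀) (a₀ * b₁))
... | inj₂ _           | inj₁ refl        = ≡⇒RoughlyEqual refl
... | inj₂ (inj₁ refl) | inj₂ (inj₁ refl) = suc⇒RoughlyEqual (suc-cross a₁ b₁)
... | inj₂ (inj₁ refl) | inj₂ (inj₂ refl) = RoughlyEqual-sym (suc⇒RoughlyEqual (suc-cross a₁ b₀))
... | inj₂ (inj₂ refl) | inj₂ (inj₁ refl) = RoughlyEqual-sym (suc⇒RoughlyEqual (suc-cross′ a₀ b₁))
... | inj₂ (inj₂ refl) | inj₂ (inj₂ refl) = suc⇒RoughlyEqual (suc-cross′ a₀ b₀)

odd≢double : ∀ m n → suc (n + n) ≢ m + m
odd≢double m n odd≡double = even≢odd m n (begin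
  2 * m         ≡⟨ cong (m +_) (+-identityʳ m) ⟩
  m + m         ≡⟨ sym odd≡double ⟩
  suc (n + n)   ≡⟨ cong (suc ∘ (n +_)) (sym (+-identityʳ n)) ⟩
  suc (2 * n)   ∎)

Even∧RoughlyEqual⇒≡ : ∀ {x y} → Even (x + y) → RoughlyEqual x y → x ≡ y
Even∧RoughlyEqual⇒≡ {x} {y} (k , x+y≡k+k) x≈y with RoughlyEqual-cases x≈y
... | inj₁ x≡y         = x≡y
... | inj₂ (inj₁ refl) = contradiction x+y≡k+k (odd≢double k y)
... | inj₂ (inj₂ refl) = contradiction (trans (sym (+-suc x x)) x+y≡k+k) (odd≢double k x)

productLabeling-friendly : ∀ {m n} (f : Labeling m) (g : Labeling n) →
  Friendly f → Friendly g → Friendly (productLabeling f g)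
productLabeling-friendly f g f-friendly g-friendly =
  subst₂ RoughlyEqual (sym (vertexCount-productLabeling f g false))
                      (sym (vertexCount-productLabeling f g true))
                      (RoughlyEqual-cross f-friendly g-friendly)

edgeCount-balanced⇒arcCount-balanced : ∀ {n} (A : Adj n) (f : Labeling n) → IsSimple A →
  edgeCount A f false ≡ edgeCount A f true → arcCount A f false ≡ arcCount A f true
edgeCount-balanced⇒arcCount-balanced A f simple balanced = begin
  arcCount A f false         ≡⟨ arcCount≡2*edgeCount A f false simple ⟩
  2 * edgeCount A f false    ≡⟨ cong (2 *_) balanced ⟩
  2 * edgeCount A f true     ≡⟨ sym (arcCount≡2*edgeCount A f true simple) ⟩
  arcCount A f true          ∎

arcCount-balanced⇒edgeCount-balanced : ∀ {n} (A : Adj n) (f : Labeling n) → IsSimple A →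
  arcCount A f false ≡ arcCount A f true → edgeCount A f false ≡ edgeCount A f true
arcCount-balanced⇒edgeCount-balanced A f simple balanced = *-cancelˡ-≡ _ _ 2 (begin
  2 * edgeCount A f false    ≡⟨ sym (arcCount≡2*edgeCount A f false simple) ⟩
  arcCount A f false         ≡⟨ balanced ⟩
  arcCount A f true          ≡⟨ arcCount≡2*edgeCount A f true simple ⟩
  2 * edgeCount A f true     ∎)

tensor-arcCount-balanced : ∀ {m n} (G₁ : Adj m) (G₂ : Adj n) (f : Labeling m) (g : Labeling n) →
  arcCount G₁ f false ≡ arcCount G₁ f true →
  arcCount (tensor G₁ G₂) (productLabeling f g) false
    ≡ arcCount (tensor G₁ G₂) (productLabeling f g) true
tensor-arcCount-balanced G₁ G₂ f g balanced = begin
  arcCount (tensor G₁ G₂) (productLabeling f g) false  ≡⟨ arcCount-tensor G₁ G₂ f g false ⟩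
  a₁ false * a₂ false + a₁ true * a₂ true              ≡⟨ cong₂ (λ k k′ → k * a₂ false + k′ * a₂ true)
                                                                balanced (sym balanced) ⟩
  a₁ true * a₂ false + a₁ false * a₂ true              ≡⟨ +-comm (a₁ true * a₂ false) _ ⟩
  a₁ false * a₂ true + a₁ true * a₂ false              ≡⟨ sym (arcCount-tensor G₁ G₂ f g true) ⟩
  arcCount (tensor G₁ G₂) (productLabeling f g) true   ∎
  where
  a₁ : Bool → ℕ
  a₁ = arcCount G₁ f

  a₂ : Bool → ℕ
  a₂ = arcCount G₂ g

theorem6 : ∀ {n₁ n₂ : ℕ} (G₁ : Adj n₁) (G₂ : Adj n₂) (f : Labeling n₁) (g : Labeling n₂) →
    IsSimple G₁ → IsSimple G₂ →
    Cordial G₁ f → Cordial G₂ g →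
    Connected G₁ → Bipartite G₁ → Even (numEdges G₁) →
    Cordial (tensor G₁ G₂) (productLabeling f g)
theorem6 G₁ G₂ f g simple₁ simple₂ (f-friendly , f-edges) (g-friendly , _) _ _ even =
  productLabeling-friendly f g f-friendly g-friendly , ≡⇒RoughlyEqual h-edges-balanced
  where
  f-edges-balanced : edgeCount G₁ f false ≡ edgeCount G₁ f true
  f-edges-balanced = Even∧RoughlyEqual⇒≡ (subst Even (numEdges≡edgeCount+edgeCount G₁ f) even) f-edges

  h-edges-balanced : edgeCount (tensor G₁ G₂) (productLabeling f g) false
                   ≡ edgeCount (tensor G₁ G₂) (productLabeling f g) true
  h-edges-balanced =
    arcCount-balanced⇒edgeCount-balanced (tensor G₁ G₂) (productLabeling f g)
      (tensor-isSimple G₁ G₂ simple₁ simple₂)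
      (tensor-arcCount-balanced G₁ G₂ f g
        (edgeCount-balanced⇒arcCount-balanced G₁ f simple₁ f-edges-balanced))
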